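{- Let $k\geq 2$ be an integer and define the subsets of $\mathbb{Z}^2$ $$B_1=([0,2k+1]\times[0,2k+1])\setminus\big(\{(2,0),(0,2)\}\cup\{(x,0),(0,y): k+2\leq x,y\leq 2k\}\big),$$ $$B_2=([0,2k+2]\times[0,2k+2])\setminus\big(\{(3,0),(0,3)\}\cup\{(x,0),(0,y): k+3\leq x,y\leq 2k+1\}\big),$$ where $[u,v]$ denotes the set of integers $t$ with $u\le t\le v$. Then for all $a,b\in\mathbb{N}$, writing $T=2k(a+b)+(a+2b)$, $$aB_1+bB_2=([0,T]\times[0,T])\setminus\Big(\{(p,0),(0,p)\}\cup\{(x,0),(0,y): k(2a+2b-1)+(a+2b+1)\leq x,y\leq 2k(a+b)+(a+2b-1)\}\Big),$$ where $p=2k(a+b-1)+(a+2b+1)$.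
   Context: For a set $B\subset\mathbb{Z}^2$ and a natural number $a$, $aB$ denotes the $a$-fold sumset $B+\cdots+B$ ($a$ copies), and $aB_1+bB_2$ is the sumset of $aB_1$ and $bB_2$. -}

module Defs where

open import Data.Nat as ℕ using (ℕ; zero; suc)
open import Data.Integer using (ℤ; +_; _+_; _-_; _*_; _≤_)
open import Data.Product using (_×_; _,_; ∃; ∃-syntax)
open import Data.Sum using (_⊎_)
open import Relation.Nullary using (¬_)
open import Relation.Binary.PropositionalEquality using (_≡_)

Point : Set
Point = ℤ × ℤ

SubsetZ2 : Set₁
SubsetZ2 = Point → Set

_+ₚ_ : Point → Point → Point
(x₁ , y₁) +ₚ (x₂ , y₂) = (x₁ + x₂ , y₁ + y₂)

_⊕_ : SubsetZ2 → SubsetZ2 → SubsetZ2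
(A ⊕ B) z = ∃[ u ] ∃[ v ] (A u × B v × z ≡ u +ₚ v)

_·_ : ℕ → SubsetZ2 → SubsetZ2
(zero · B) z = z ≡ (+ 0 , + 0)
(suc n · B) = (n · B) ⊕ B

Square : ℤ → SubsetZ2
Square T (x , y) = (+ 0 ≤ x × x ≤ T) × (+ 0 ≤ y × y ≤ T)

Excluded : ℤ → ℤ → ℤ → SubsetZ2
Excluded p lo hi z =
  (z ≡ (p , + 0)) ⊎ (z ≡ (+ 0 , p))
  ⊎ (∃[ x ] (lo ≤ x × x ≤ hi × z ≡ (x , + 0)))
  ⊎ (∃[ y ] (lo ≤ y × y ≤ hi × z ≡ (+ 0 , y)))

Shape : ℤ → ℤ → ℤ → ℤ → SubsetZ2
Shape T p lo hi z = Square T z × ¬ Excluded p lo hi z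

B₁ : ℕ → SubsetZ2
B₁ k = Shape (+ 2 * + k + + 1) (+ 2) (+ k + + 2) (+ 2 * + k)

B₂ : ℕ → SubsetZ2
B₂ k = Shape (+ 2 * + k + + 2) (+ 3) (+ k + + 3) (+ 2 * + k + + 1)

module Submission where

-- Write Block T for [0,T]² minus (T-2k+1, 0), (0, T-2k+1) and the axis points with a coordinate
-- in [T-k+1, T-1]. Then B₁ = Block (2k+1), B₂ = Block (2k+2), 0B = {0} = Block 0, and the claimed
-- sumset is Block (a(2k+1) + b(2k+2)); so everything follows from Block T + Block T′ = Block (T + T′)
-- for T, T′ ≥ 2k+1. Writing T = s + 2k, a point of Block T either has both coordinates positive or
-- lies on an axis with coordinate in [0,s] ∪ [s+2,s+k] ∪ {s+2k}. These one-dimensional sets add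
-- exactly: the sets for s and t sum to the set for s + t + 2k, and decomposing s + t + d with
-- 1 ≤ d ≤ 2k is the one place where k ≥ 2 is needed. A point with positive coordinates splits into
-- two such points, except when a coordinate is 1, where an axis point of one summand is used.

open import Defs
open import Data.Nat as ℕ using (ℕ)
open import Function.Bundles using (_⇔_; mk⇔)
open import Data.Product using (_×_; _,_; ∃-syntax; proj₁; proj₂)
open import Data.Sum using (_⊎_; inj₁; inj₂)
open import Level using (0ℓ)
open import Relation.Nullary using (¬_; contradiction)
open import Relation.Unary using (_⊆_; _≐_)
open import Relation.Unary.Properties using (≐-refl; ≐-sym; ≐-trans)
open import Relation.Unary.Relation.Binary.Equality using (≐-setoid)
open import Relation.Binary.PropositionalEquality
  using (_≡_; _≢_; refl; sym; trans; cong; cong₂; subst; module ≡-Reasoning)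

module Splitting where
  open import Data.Nat using (zero; suc; _+_; _≤_; _<_; z≤n; s≤s; s≤s⁻¹)
  open import Data.Nat.Properties
    using (≤-refl; ≤-trans; ≤-reflexive; <⇒≱; +-comm; +-suc; +-cancelˡ-≤; +-identityʳ)

  below-or-above : ∀ m x → x ≤ m ⊎ ∃[ e ] x ≡ m + suc e
  below-or-above m       zero    = inj₁ z≤n
  below-or-above zero    (suc x) = inj₂ (x , refl)
  below-or-above (suc m) (suc x) with below-or-above m x
  ... | inj₁ x≤m      = inj₁ (s≤s x≤m)
  ... | inj₂ (e , x≡) = inj₂ (e , cong suc x≡)

  ≤-split : ∀ p q {x} → x ≤ p + q → ∃[ a ] ∃[ b ] a ≤ p × b ≤ q × x ≡ a + b
  ≤-split p q {x} x≤p+q with below-or-above p x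
  ... | inj₁ x≤p = x , 0 , x≤p , z≤n , sym (+-identityʳ x)
  ... | inj₂ (e , refl) = p , suc e , ≤-refl , +-cancelˡ-≤ p _ _ x≤p+q , refl

  ≤-split-positive : ∀ p q {x} → 2 ≤ x → x ≤ suc p + suc q →
                     ∃[ a ] ∃[ b ] 0 < a × a ≤ suc p × 0 < b × b ≤ suc q × x ≡ a + b
  ≤-split-positive p q (s≤s (s≤s (z≤n {n = x}))) x≤
    with ≤-split p q (s≤s⁻¹ (s≤s⁻¹ (≤-trans x≤ (≤-reflexive (cong suc (+-suc p q))))))
  ... | a , b , a≤p , b≤q , x≡ =
    suc a , suc b , s≤s z≤n , s≤s a≤p , s≤s z≤n , s≤s b≤q , cong suc (trans (cong suc x≡) (sym (+-suc a b)))

  excess : ∀ {m n} → m < n → ∃[ e ] 0 < e × n ≡ e + m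
  excess {m} {n} m<n with below-or-above m n
  ... | inj₁ n≤m = contradiction n≤m (<⇒≱ m<n)
  ... | inj₂ (e , n≡) = suc e , s≤s z≤n , trans n≡ (+-comm m (suc e))

  _⊹_ : (ℕ → Set) → (ℕ → Set) → ℕ → Set
  (P ⊹ Q) x = ∃[ x₁ ] ∃[ x₂ ] P x₁ × Q x₂ × x ≡ x₁ + x₂

  _⊞_ : (ℕ → ℕ → Set) → (ℕ → ℕ → Set) → ℕ → ℕ → Set
  (P ⊞ Q) x y = ∃[ x₁ ] ∃[ y₁ ] ∃[ x₂ ] ∃[ y₂ ] P x₁ y₁ × Q x₂ y₂ × x ≡ x₁ + x₂ × y ≡ y₁ + y₂

module Grids (k : ℕ) where
  open Splitting
  open import Data.Nat using (zero; suc; _+_; _*_; _≤_; _<_; z≤n; s≤s)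
  open import Data.Nat.Properties
    using (≤-refl; ≤-trans; ≤-reflexive; <-irrefl; ≤-antisym; +-mono-≤; +-monoʳ-≤; +-monoʳ-<;
           +-cancelˡ-≤; +-cancelˡ-≡; +-cancelʳ-≤; +-comm; +-suc; m≤m+n; m<m+n; n≤1+n; m+1+n≢m; m+1+n≢0;
           suc-injective; n>0⇒n≢0; <⇒≱; m+n≡0⇒m≡0; m+n≡0⇒n≡0; m≤n⇒m<n∨m≡n)
  open import Data.Nat.Tactic.RingSolver using (solve)
  open import Data.List using (_∷_; [])
  open Data.Nat.Properties.≤-Reasoning

  side : ℕ → ℕ
  side s = s + 2 * k

  data Axis (s : ℕ) : ℕ → Set where
    initial : ∀ {x} → x ≤ s → Axis s x
    middle  : ∀ {d} → 2 ≤ d → d ≤ k → Axis s (s + d)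
    final   : Axis s (s + 2 * k)

  Axis-≤ : ∀ {s x} → Axis s x → x ≤ side s
  Axis-≤ {s} (initial x≤s) = ≤-trans x≤s (m≤m+n s _)
  Axis-≤ {s} (middle _ d≤k) = +-monoʳ-≤ s (≤-trans d≤k (m≤m+n k _))
  Axis-≤ final = ≤-refl

  Axis-+ : ∀ {s t x₁ x₂} → Axis s x₁ → Axis t x₂ → Axis (s + t + 2 * k) (x₁ + x₂)
  Axis-+ {s} {t} {x₁} {x₂} (initial x₁≤s) a₂ = initial (begin
    x₁ + x₂            ≤⟨ +-mono-≤ x₁≤s (Axis-≤ a₂) ⟩
    s + (t + 2 * k)    ≡⟨ solve (s ∷ t ∷ k ∷ []) ⟩
    s + t + 2 * k      ∎)
  Axis-+ {s} {t} {x₁} {x₂} a₁ (initial x₂≤t) = initial (begin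
    x₁ + x₂            ≤⟨ +-mono-≤ (Axis-≤ a₁) x₂≤t ⟩
    s + 2 * k + t      ≡⟨ solve (s ∷ t ∷ k ∷ []) ⟩
    s + t + 2 * k      ∎)
  Axis-+ {s} {t} (middle {d₁} _ d₁≤k) (middle {d₂} _ d₂≤k) = initial (begin
    s + d₁ + (t + d₂)  ≡⟨ solve (s ∷ t ∷ d₁ ∷ d₂ ∷ []) ⟩
    s + t + (d₁ + d₂)  ≤⟨ +-monoʳ-≤ (s + t) (+-mono-≤ d₁≤k d₂≤k) ⟩
    s + t + (k + k)    ≡⟨ solve (s ∷ t ∷ k ∷ []) ⟩
    s + t + 2 * k      ∎)
  Axis-+ {s} {t} (middle {d} 2≤d d≤k) final = subst (Axis _) eq (middle 2≤d d≤k)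
    where eq : s + t + 2 * k + d ≡ s + d + (t + 2 * k)
          eq = solve (s ∷ t ∷ k ∷ d ∷ [])
  Axis-+ {s} {t} final (middle {d} 2≤d d≤k) = subst (Axis _) eq (middle 2≤d d≤k)
    where eq : s + t + 2 * k + d ≡ s + 2 * k + (t + d)
          eq = solve (s ∷ t ∷ k ∷ d ∷ [])
  Axis-+ {s} {t} final final = subst (Axis _) eq final
    where eq : s + t + 2 * k + 2 * k ≡ s + 2 * k + (t + 2 * k)
          eq = solve (s ∷ t ∷ k ∷ [])

  split-below : ∀ s t {x} → x ≤ s + t → (Axis s ⊹ Axis t) x
  split-below s t x≤s+t with ≤-split s t x≤s+t
  ... | a , b , a≤s , b≤t , x≡ = a , b , initial a≤s , initial b≤t , x≡

  split-above-low : 2 ≤ k → ∀ s t {d} → 1 ≤ d → d ≤ k → (Axis (suc s) ⊹ Axis t) (suc s + t + d)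
  split-above-low 2≤k s t {1} _ _ = s , t + 2 , initial (n≤1+n s) , middle ≤-refl 2≤k , eq
    where eq : suc s + t + 1 ≡ s + (t + 2)
          eq = solve (s ∷ t ∷ [])
  split-above-low _ s t {suc (suc d)} _ d≤k =
    suc s , t + suc (suc d) , initial ≤-refl , middle (s≤s (s≤s z≤n)) d≤k , eq
    where eq : suc s + t + suc (suc d) ≡ suc s + (t + suc (suc d))
          eq = solve (s ∷ t ∷ d ∷ [])

  split-above-high : 2 ≤ k → ∀ s t e → k + suc e ≤ 2 * k → (Axis (suc s) ⊹ Axis t) (suc s + t + (k + suc e))
  split-above-high 2≤k s t (suc e) d≤2k =
    suc s + suc (suc e) , t + k , middle (s≤s (s≤s z≤n)) e≤k , middle 2≤k ≤-refl , eq
    where e≤k : suc (suc e) ≤ k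
          e≤k = +-cancelˡ-≤ k _ _ (≤-trans d≤2k (≤-reflexive (solve (k ∷ []))))
          eq : suc s + t + (k + suc (suc e)) ≡ suc s + suc (suc e) + (t + k)
          eq = solve (s ∷ t ∷ k ∷ e ∷ [])
  -- d = k + 1 is the sum of two middle offsets only when k ≥ 3; for k = 2 use (s - 1) + (t + 2k).
  split-above-high 2≤k s t zero _ with below-or-above 2 k
  ... | inj₁ k≤2 = s , t + 2 * k , initial (n≤1+n s) , final , eq
    where eq : suc s + t + (k + 1) ≡ s + (t + 2 * k)
          eq = subst (λ k → suc s + t + (k + 1) ≡ s + (t + 2 * k)) (≤-antisym 2≤k k≤2) (solve (s ∷ t ∷ []))
  ... | inj₂ (f , k≡) = suc s + 2 , t + (2 + f) , middle ≤-refl 2≤k , middle (m≤m+n 2 f) f≤k , eq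
    where f≤k : 2 + f ≤ k
          f≤k = ≤-trans (n≤1+n (2 + f)) (≤-reflexive (sym k≡))
          eq : suc s + t + (k + 1) ≡ suc s + 2 + (t + (2 + f))
          eq = subst (λ k → suc s + t + (k + 1) ≡ suc s + 2 + (t + (2 + f))) (sym k≡) (solve (s ∷ t ∷ f ∷ []))

  split-above : 2 ≤ k → ∀ s t d → 1 ≤ d → d ≤ 2 * k → (Axis (suc s) ⊹ Axis t) (suc s + t + d)
  split-above 2≤k s t d 1≤d d≤2k with below-or-above k d
  ... | inj₁ d≤k = split-above-low 2≤k s t 1≤d d≤k
  ... | inj₂ (e , refl) = split-above-high 2≤k s t e d≤2k

  Axis-split : 2 ≤ k → ∀ {s t x} → 1 ≤ s → Axis (s + t + 2 * k) x → (Axis s ⊹ Axis t) x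
  Axis-split 2≤k {suc s} {t} {x} _ (initial x≤S) with below-or-above (suc s + t) x
  ... | inj₁ x≤s+t = split-below (suc s) t x≤s+t
  ... | inj₂ (d , refl) = split-above 2≤k s t (suc d) (s≤s z≤n) (+-cancelˡ-≤ (suc s + t) _ _ x≤S)
  Axis-split _ {s} {t} _ (middle {d} 2≤d d≤k) = s + 2 * k , t + d , final , middle 2≤d d≤k , eq
    where eq : s + t + 2 * k + d ≡ s + 2 * k + (t + d)
          eq = solve (s ∷ t ∷ k ∷ d ∷ [])
  Axis-split _ {s} {t} _ final = s + 2 * k , t + 2 * k , final , final , eq
    where eq : s + t + 2 * k + 2 * k ≡ s + 2 * k + (t + 2 * k)
          eq = solve (s ∷ t ∷ k ∷ [])

  Gap : ℕ → ℕ → Set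
  Gap s x = x ≡ suc s ⊎ (suc (s + k) ≤ x × x < s + 2 * k)

  Gap⇒> : ∀ {s x} → Gap s x → s < x
  Gap⇒> (inj₁ refl) = ≤-refl
  Gap⇒> {s} (inj₂ (s+k<x , _)) = ≤-trans (s≤s (m≤m+n s k)) s+k<x

  2*n≢1 : ∀ n → 2 * n ≢ 1
  2*n≢1 zero ()
  2*n≢1 (suc n) eq = m+1+n≢0 n (suc-injective eq)

  Axis⇒¬Gap : ∀ {s x} → Axis s x → ¬ Gap s x
  Axis⇒¬Gap (initial x≤s) gap = <⇒≱ (Gap⇒> gap) x≤s
  Axis⇒¬Gap {s} (middle (s≤s (s≤s {n = d} _)) _) (inj₁ eq) =
    m+1+n≢m s (suc-injective (trans (sym (+-suc s (suc d))) eq))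
  Axis⇒¬Gap {s} (middle _ d≤k) (inj₂ (s+k<x , _)) = <⇒≱ s+k<x (+-monoʳ-≤ s d≤k)
  Axis⇒¬Gap {s} final (inj₁ eq) = 2*n≢1 k (+-cancelˡ-≡ s _ _ (trans eq (+-comm 1 s)))
  Axis⇒¬Gap final (inj₂ (_ , x<x)) = <-irrefl refl x<x

  ¬Gap⇒Axis : ∀ {s x} → x ≤ side s → ¬ Gap s x → Axis s x
  ¬Gap⇒Axis {s} {x} x≤T ¬gap with m≤n⇒m<n∨m≡n x≤T
  ... | inj₂ refl = final
  ... | inj₁ x<T with below-or-above s x
  ...   | inj₁ x≤s = initial x≤s
  ...   | inj₂ (zero , refl) = contradiction (inj₁ (+-comm s 1)) ¬gap
  ...   | inj₂ (suc e , refl) with below-or-above k (suc (suc e))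
  ...     | inj₁ d≤k = middle (s≤s (s≤s z≤n)) d≤k
  ...     | inj₂ (f , d≡) = contradiction (inj₂ (+-monoʳ-< s k<d , x<T)) ¬gap
    where k<d : k < suc (suc e)
          k<d = subst (k <_) (sym d≡) (m<m+n k (s≤s z≤n))

  Grid : ℕ → ℕ → ℕ → Set
  Grid s x y = x ≤ side s × y ≤ side s × (y ≡ 0 → Axis s x) × (x ≡ 0 → Axis s y)

  Grid-transpose : ∀ {s x y} → Grid s x y → Grid s y x
  Grid-transpose (x≤ , y≤ , on-x , on-y) = y≤ , x≤ , on-y , on-x

  Grid-interior : ∀ {s x y} → 0 < x → 0 < y → x ≤ side s → y ≤ side s → Grid s x y
  Grid-interior 0<x 0<y x≤ y≤ =
    x≤ , y≤ , (λ y≡0 → contradiction y≡0 (n>0⇒n≢0 0<y)) , (λ x≡0 → contradiction x≡0 (n>0⇒n≢0 0<x))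

  Grid-x-axis : ∀ {s x} → Axis s x → Grid s x 0
  Grid-x-axis a = Axis-≤ a , z≤n , (λ _ → a) , (λ _ → initial z≤n)

  Grid-y-axis : ∀ {s y} → Axis s y → Grid s 0 y
  Grid-y-axis a = Grid-transpose (Grid-x-axis a)

  side-+ : ∀ s t → side s + side t ≡ side (s + t + 2 * k)
  side-+ s t = identity
    where identity : s + 2 * k + (t + 2 * k) ≡ s + t + 2 * k + 2 * k
          identity = solve (s ∷ t ∷ k ∷ [])

  Grid-+ : ∀ {s t x y} → (Grid s ⊞ Grid t) x y → Grid (s + t + 2 * k) x y
  Grid-+ {s} {t} (x₁ , y₁ , _ , _ , (x₁≤ , y₁≤ , on-x₁ , on-y₁) , (x₂≤ , y₂≤ , on-x₂ , on-y₂) , refl , refl) =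
    ≤-trans (+-mono-≤ x₁≤ x₂≤) (≤-reflexive (side-+ s t))
    , ≤-trans (+-mono-≤ y₁≤ y₂≤) (≤-reflexive (side-+ s t))
    , (λ y≡0 → Axis-+ (on-x₁ (m+n≡0⇒m≡0 y₁ y≡0)) (on-x₂ (m+n≡0⇒n≡0 y₁ y≡0)))
    , (λ x≡0 → Axis-+ (on-y₁ (m+n≡0⇒m≡0 x₁ x≡0)) (on-y₂ (m+n≡0⇒n≡0 x₁ x≡0)))

  Grid-⊞-transpose : ∀ {s t x y} → (Grid s ⊞ Grid t) x y → (Grid s ⊞ Grid t) y x
  Grid-⊞-transpose (x₁ , y₁ , x₂ , y₂ , g₁ , g₂ , x≡ , y≡) =
    y₁ , x₁ , y₂ , x₂ , Grid-transpose g₁ , Grid-transpose g₂ , y≡ , x≡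

  Grid-split-edge : ∀ {s t y} → 1 ≤ s → 0 < y → y ≤ side s + side t → (Grid s ⊞ Grid t) 1 y
  Grid-split-edge {s} {t} {y} 1≤s 0<y y≤ with below-or-above (side t) y
  ... | inj₁ y≤Q =
    0 , 0 , 1 , y , Grid-x-axis (initial z≤n) , Grid-interior ≤-refl 0<y (≤-trans 0<y y≤Q) y≤Q , refl , refl
  ... | inj₂ (e , refl) =
    1 , suc e , 0 , side t , Grid-interior ≤-refl (s≤s z≤n) (≤-trans 1≤s (m≤m+n s _)) e≤P , Grid-y-axis final
    , refl , +-comm (side t) (suc e)
    where e≤P : suc e ≤ side s
          e≤P = +-cancelʳ-≤ (side t) _ _ (≤-trans (≤-reflexive (+-comm (suc e) (side t))) y≤)

  Grid-split-interior : ∀ {s t x y} → 1 ≤ s → 1 ≤ t → 0 < x → 0 < y →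
                        x ≤ side s + side t → y ≤ side s + side t → (Grid s ⊞ Grid t) x y
  Grid-split-interior {x = 1} 1≤s _ _ 0<y _ y≤ = Grid-split-edge 1≤s 0<y y≤
  Grid-split-interior {x = suc (suc x)} {y = 1} 1≤s _ 0<x _ x≤ _ = Grid-⊞-transpose (Grid-split-edge 1≤s 0<x x≤)
  Grid-split-interior {suc s} {suc t} {suc (suc x)} {suc (suc y)} _ _ _ _ x≤ y≤
    with ≤-split-positive (side s) (side t) (s≤s (s≤s z≤n)) x≤
       | ≤-split-positive (side s) (side t) (s≤s (s≤s z≤n)) y≤
  ... | x₁ , x₂ , 0<x₁ , x₁≤ , 0<x₂ , x₂≤ , x≡ | y₁ , y₂ , 0<y₁ , y₁≤ , 0<y₂ , y₂≤ , y≡ =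
    x₁ , y₁ , x₂ , y₂ , Grid-interior 0<x₁ 0<y₁ x₁≤ y₁≤ , Grid-interior 0<x₂ 0<y₂ x₂≤ y₂≤ , x≡ , y≡

  Grid-split : 2 ≤ k → ∀ {s t x y} → 1 ≤ s → 1 ≤ t → Grid (s + t + 2 * k) x y → (Grid s ⊞ Grid t) x y
  Grid-split 2≤k {y = zero} 1≤s _ (_ , _ , on-x , _) with Axis-split 2≤k 1≤s (on-x refl)
  ... | x₁ , x₂ , a₁ , a₂ , x≡ = x₁ , 0 , x₂ , 0 , Grid-x-axis a₁ , Grid-x-axis a₂ , x≡ , refl
  Grid-split 2≤k {x = zero} {y = suc y} 1≤s _ (_ , _ , _ , on-y) with Axis-split 2≤k 1≤s (on-y refl)
  ... | y₁ , y₂ , a₁ , a₂ , y≡ = 0 , y₁ , 0 , y₂ , Grid-y-axis a₁ , Grid-y-axis a₂ , refl , y≡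
  Grid-split _ {s} {t} {suc x} {suc y} 1≤s 1≤t (x≤ , y≤ , _) =
    Grid-split-interior 1≤s 1≤t (s≤s z≤n) (s≤s z≤n) (≤-trans x≤ sides) (≤-trans y≤ sides)
    where sides : side (s + t + 2 * k) ≤ side s + side t
          sides = ≤-reflexive (sym (side-+ s t))

open import Data.Integer using (ℤ; +_; _+_; _-_; _*_; ∣_∣; +≤+; +<+)
open import Data.Integer.Properties as ℤP using (pos-*; abs-*; drop‿+≤+; drop‿+<+; i≤pred[j]⇒i<j; i<j⇒i≤pred[j])
import Data.Integer.Tactic.RingSolver as ℤRing
import Data.Nat.Properties as ℕP
open import Algebra.Properties.CommutativeSemigroup ℕP.+-commutativeSemigroup using (xy∙z≈zx∙y; xy∙z≈x∙zy)

Origin : SubsetZ2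
Origin z = z ≡ (+ 0 , + 0)

⊕-mono : ∀ {A A′ B B′} → A ⊆ A′ → B ⊆ B′ → A ⊕ B ⊆ A′ ⊕ B′
⊕-mono A⊆A′ B⊆B′ (u , v , u∈A , v∈B , z≡) = u , v , A⊆A′ u∈A , B⊆B′ v∈B , z≡

⊕-cong : ∀ {A A′ B B′} → A ≐ A′ → B ≐ B′ → A ⊕ B ≐ A′ ⊕ B′
⊕-cong (A⊆A′ , A′⊆A) (B⊆B′ , B′⊆B) = ⊕-mono A⊆A′ B⊆B′ , ⊕-mono A′⊆A B′⊆B

+ₚ-assoc : ∀ u v w → (u +ₚ v) +ₚ w ≡ u +ₚ (v +ₚ w)
+ₚ-assoc (x₁ , y₁) (x₂ , y₂) (x₃ , y₃) = cong₂ _,_ (ℤP.+-assoc x₁ x₂ x₃) (ℤP.+-assoc y₁ y₂ y₃)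

+ₚ-identityˡ : ∀ u → (+ 0 , + 0) +ₚ u ≡ u
+ₚ-identityˡ (x , y) = cong₂ _,_ (ℤP.+-identityˡ x) (ℤP.+-identityˡ y)

+ₚ-identityʳ : ∀ u → u +ₚ (+ 0 , + 0) ≡ u
+ₚ-identityʳ (x , y) = cong₂ _,_ (ℤP.+-identityʳ x) (ℤP.+-identityʳ y)

⊕-assoc : ∀ {A B C} → A ⊕ (B ⊕ C) ≐ (A ⊕ B) ⊕ C
⊕-assoc = (λ { (u , _ , u∈A , (v , w , v∈B , w∈C , refl) , refl) →
                 u +ₚ v , w , (u , v , u∈A , v∈B , refl) , w∈C , sym (+ₚ-assoc u v w) })
        , (λ { (_ , w , (u , v , u∈A , v∈B , refl) , w∈C , refl) →
                 u , v +ₚ w , u∈A , (v , w , v∈B , w∈C , refl) , +ₚ-assoc u v w })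

⊕-identityˡ : ∀ {A} → Origin ⊕ A ≐ A
⊕-identityˡ {A} = (λ { (_ , v , refl , v∈A , refl) → subst A (sym (+ₚ-identityˡ v)) v∈A })
                , (λ {z} z∈A → (+ 0 , + 0) , z , refl , z∈A , sym (+ₚ-identityˡ z))

⊕-identityʳ : ∀ {A} → A ⊕ Origin ≐ A
⊕-identityʳ {A} = (λ { (u , _ , u∈A , refl , refl) → subst A (sym (+ₚ-identityʳ u)) u∈A })
                , (λ {z} z∈A → z , (+ 0 , + 0) , z∈A , refl , sym (+ₚ-identityʳ z))

≡⇒≐ : ∀ {A B : SubsetZ2} → A ≡ B → A ≐ B
≡⇒≐ refl = ≐-refl

open Splitting using (_⊞_)

Lift : (ℕ → ℕ → Set) → SubsetZ2
Lift P z = ∃[ x ] ∃[ y ] z ≡ (+ x , + y) × P x y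

Lift-≐ : ∀ {P Q} → (∀ {x y} → P x y → Q x y) → (∀ {x y} → Q x y → P x y) → Lift P ≐ Lift Q
Lift-≐ P⇒Q Q⇒P = (λ (x , y , z≡ , p) → x , y , z≡ , P⇒Q p) , (λ (x , y , z≡ , q) → x , y , z≡ , Q⇒P q)

Lift-⊕ : ∀ {P Q} → Lift P ⊕ Lift Q ≐ Lift (P ⊞ Q)
Lift-⊕ = (λ { (_ , _ , (x₁ , y₁ , refl , p) , (x₂ , y₂ , refl , q) , refl) →
               x₁ ℕ.+ x₂ , y₁ ℕ.+ y₂ , refl , x₁ , y₁ , x₂ , y₂ , p , q , refl , refl })
       , (λ { (_ , _ , refl , x₁ , y₁ , x₂ , y₂ , p , q , refl , refl) →
               (+ x₁ , + y₁) , (+ x₂ , + y₂) , (x₁ , y₁ , refl , p) , (x₂ , y₂ , refl , q) , refl })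

module Blocks (k : ℕ) where
  open Splitting using (excess)
  open Grids k

  Block : ℤ → SubsetZ2
  Block T = Shape T (T - + 2 * + k + + 1) (T - + k + + 1) (T - + 1)

  Block≡Shape : ∀ {T p lo hi} → T - + 2 * + k + + 1 ≡ p → T - + k + + 1 ≡ lo → T - + 1 ≡ hi →
                Block T ≡ Shape T p lo hi
  Block≡Shape refl refl refl = refl

  +side : ∀ s → + side s ≡ + s + + 2 * + k
  +side s = cong (λ n → + s + n) (pos-* 2 k)

  Block-at-side : ∀ s → Block (+ side s) ≡ Shape (+ side s) (+ ℕ.suc s) (+ ℕ.suc (s ℕ.+ k)) (+ side s - + 1)
  Block-at-side s = Block≡Shape (trans (cong (λ T → T - + 2 * + k + + 1) (+side s)) (p≡ (+ s) (+ k)))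
                                (trans (cong (λ T → T - + k + + 1) (+side s)) (lo≡ (+ s) (+ k)))
                                refl
    where
    p≡ : ∀ S K → S + + 2 * K - + 2 * K + + 1 ≡ + 1 + S
    p≡ = ℤRing.solve-∀
    lo≡ : ∀ S K → S + + 2 * K - K + + 1 ≡ + 1 + (S + K)
    lo≡ = ℤRing.solve-∀

  private
    Excludedₛ : ℕ → SubsetZ2
    Excludedₛ s = Excluded (+ ℕ.suc s) (+ ℕ.suc (s ℕ.+ k)) (+ side s - + 1)

  Gap⇒Excluded-x : ∀ {s x y} → y ≡ 0 → Gap s x → Excludedₛ s (+ x , + y)
  Gap⇒Excluded-x refl (inj₁ refl) = inj₁ refl
  Gap⇒Excluded-x {s} {x} refl (inj₂ (s+k<x , x<T)) =
    inj₂ (inj₂ (inj₁ (+ x , +≤+ s+k<x , i<j⇒i≤pred[j] (+<+ x<T) , refl)))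

  Gap⇒Excluded-y : ∀ {s x y} → x ≡ 0 → Gap s y → Excludedₛ s (+ x , + y)
  Gap⇒Excluded-y refl (inj₁ refl) = inj₂ (inj₁ refl)
  Gap⇒Excluded-y {s} {y = y} refl (inj₂ (s+k<y , y<T)) =
    inj₂ (inj₂ (inj₂ (+ y , +≤+ s+k<y , i<j⇒i≤pred[j] (+<+ y<T) , refl)))

  -- + side s - + 1 and pred (+ side s) agree only after unfolding, so j is given explicitly.
  Grid⇒¬Excluded : ∀ {s x y} → Grid s x y → ¬ Excludedₛ s (+ x , + y)
  Grid⇒¬Excluded (_ , _ , on-x , _) (inj₁ refl) = Axis⇒¬Gap (on-x refl) (inj₁ refl)
  Grid⇒¬Excluded (_ , _ , _ , on-y) (inj₂ (inj₁ refl)) = Axis⇒¬Gap (on-y refl) (inj₁ refl)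
  Grid⇒¬Excluded {s} (_ , _ , on-x , _) (inj₂ (inj₂ (inj₁ (_ , lo≤x , x≤hi , refl)))) =
    Axis⇒¬Gap (on-x refl) (inj₂ (drop‿+≤+ lo≤x , drop‿+<+ (i≤pred[j]⇒i<j {j = + side s} x≤hi)))
  Grid⇒¬Excluded {s} (_ , _ , _ , on-y) (inj₂ (inj₂ (inj₂ (_ , lo≤y , y≤hi , refl)))) =
    Axis⇒¬Gap (on-y refl) (inj₂ (drop‿+≤+ lo≤y , drop‿+<+ (i≤pred[j]⇒i<j {j = + side s} y≤hi)))

  Block≐Grid : ∀ s → Block (+ side s) ≐ Lift (Grid s)
  Block≐Grid s = subst (_≐ Lift (Grid s)) (sym (Block-at-side s)) (to , from)
    where
    to : Shape (+ side s) (+ ℕ.suc s) (+ ℕ.suc (s ℕ.+ k)) (+ side s - + 1) ⊆ Lift (Grid s)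
    to {+ x , + y} (((_ , +≤+ x≤) , (_ , +≤+ y≤)) , ¬excluded) =
      x , y , refl , x≤ , y≤
      , (λ y≡0 → ¬Gap⇒Axis x≤ (λ gap → ¬excluded (Gap⇒Excluded-x y≡0 gap)))
      , (λ x≡0 → ¬Gap⇒Axis y≤ (λ gap → ¬excluded (Gap⇒Excluded-y x≡0 gap)))
    from : Lift (Grid s) ⊆ Shape (+ side s) (+ ℕ.suc s) (+ ℕ.suc (s ℕ.+ k)) (+ side s - + 1)
    from (x , y , refl , g@(x≤ , y≤ , _)) = ((+≤+ ℕ.z≤n , +≤+ x≤) , (+≤+ ℕ.z≤n , +≤+ y≤)) , Grid⇒¬Excluded g

  Block-origin : Block (+ 0) ≐ Origin
  Block-origin = to , from
    where
    to : Block (+ 0) ⊆ Origin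
    to (((0≤x , x≤0) , (0≤y , y≤0)) , _) = cong₂ _,_ (ℤP.≤-antisym x≤0 0≤x) (ℤP.≤-antisym y≤0 0≤y)
    -- p = 1 - 2k is odd.
    p≢0 : + 0 - + 2 * + k + + 1 ≢ + 0
    p≢0 p≡0 =
      2*n≢1 k (trans (sym (abs-* (+ 2) (+ k))) (cong ∣_∣ (trans (2K≡ (+ k)) (cong (λ p → + 1 - p) p≡0))))
      where 2K≡ : ∀ K → + 2 * K ≡ + 1 - (+ 0 - + 2 * K + + 1)
            2K≡ = ℤRing.solve-∀
    ¬excluded : ¬ Excluded (+ 0 - + 2 * + k + + 1) (+ 0 - + k + + 1) (+ 0 - + 1) (+ 0 , + 0)
    ¬excluded (inj₁ eq) = p≢0 (sym (cong proj₁ eq))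
    ¬excluded (inj₂ (inj₁ eq)) = p≢0 (sym (cong proj₂ eq))
    ¬excluded (inj₂ (inj₂ (inj₁ (.(+ 0) , _ , () , refl))))
    ¬excluded (inj₂ (inj₂ (inj₂ (.(+ 0) , _ , () , refl))))
    from : Origin ⊆ Block (+ 0)
    from refl = ((ℤP.≤-refl , ℤP.≤-refl) , (ℤP.≤-refl , ℤP.≤-refl)) , ¬excluded

  Block-⊕ : 2 ℕ.≤ k → ∀ {m n} → m ≡ 0 ⊎ 2 ℕ.* k ℕ.< m → 2 ℕ.* k ℕ.< n →
            Block (+ m) ⊕ Block (+ n) ≐ Block (+ (m ℕ.+ n))
  Block-⊕ _ (inj₁ refl) _ = ≐-trans (⊕-cong Block-origin ≐-refl) ⊕-identityˡ
  Block-⊕ 2≤k (inj₂ 2k<m) 2k<n with excess 2k<m | excess 2k<n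
  ... | s , 1≤s , refl | t , 1≤t , refl = begin
    Block (+ side s) ⊕ Block (+ side t)       ≈⟨ ⊕-cong (Block≐Grid s) (Block≐Grid t) ⟩
    Lift (Grid s) ⊕ Lift (Grid t)             ≈⟨ Lift-⊕ ⟩
    Lift (Grid s ⊞ Grid t)                    ≈⟨ Lift-≐ Grid-+ (Grid-split 2≤k 1≤s 1≤t) ⟩
    Lift (Grid (s ℕ.+ t ℕ.+ 2 ℕ.* k))         ≈⟨ ≐-sym (Block≐Grid (s ℕ.+ t ℕ.+ 2 ℕ.* k)) ⟩
    Block (+ side (s ℕ.+ t ℕ.+ 2 ℕ.* k))      ≡⟨ cong (λ n → Block (+ n)) (sym (side-+ s t)) ⟩
    Block (+ (side s ℕ.+ side t))             ∎
    where open import Relation.Binary.Reasoning.Setoid (≐-setoid Point 0ℓ)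

  B₁≡Block : B₁ k ≡ Block (+ side 1)
  B₁≡Block = trans (sym (Block≡Shape (p≡ (+ k)) (lo≡ (+ k)) (hi≡ (+ k))))
                   (cong Block (sym (trans (+side 1) (ℤP.+-comm (+ 1) (+ 2 * + k)))))
    where
    p≡ : ∀ K → + 2 * K + + 1 - + 2 * K + + 1 ≡ + 2
    p≡ = ℤRing.solve-∀
    lo≡ : ∀ K → + 2 * K + + 1 - K + + 1 ≡ K + + 2
    lo≡ = ℤRing.solve-∀
    hi≡ : ∀ K → + 2 * K + + 1 - + 1 ≡ + 2 * K
    hi≡ = ℤRing.solve-∀

  B₂≡Block : B₂ k ≡ Block (+ side 2)
  B₂≡Block = trans (sym (Block≡Shape (p≡ (+ k)) (lo≡ (+ k)) (hi≡ (+ k))))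
                   (cong Block (sym (trans (+side 2) (ℤP.+-comm (+ 2) (+ 2 * + k)))))
    where
    p≡ : ∀ K → + 2 * K + + 2 - + 2 * K + + 1 ≡ + 3
    p≡ = ℤRing.solve-∀
    lo≡ : ∀ K → + 2 * K + + 2 - K + + 1 ≡ K + + 3
    lo≡ = ℤRing.solve-∀
    hi≡ : ∀ K → + 2 * K + + 2 - + 1 ≡ + 2 * K + + 1
    hi≡ = ℤRing.solve-∀

  size : ℕ → ℕ → ℕ
  size a b = a ℕ.* side 1 ℕ.+ b ℕ.* side 2

  size≡0⊎2k<size : ∀ a b → size a b ≡ 0 ⊎ 2 ℕ.* k ℕ.< size a b
  size≡0⊎2k<size ℕ.zero ℕ.zero = inj₁ refl
  size≡0⊎2k<size (ℕ.suc a) b = inj₂ (ℕP.≤-trans (ℕP.m≤m+n (side 1) _) (ℕP.m≤m+n _ (b ℕ.* side 2)))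
  size≡0⊎2k<size ℕ.zero (ℕ.suc b) = inj₂ (ℕP.≤-trans (ℕP.n≤1+n _) (ℕP.m≤m+n (side 2) _))

  size≡ : ∀ a b → + size a b ≡ + 2 * + k * (+ a + + b) + (+ a + + 2 * + b)
  size≡ a b = begin
    + size a b                                         ≡⟨ cong₂ _+_ (pos-* a _) (pos-* b _) ⟩
    + a * + side 1 + + b * + side 2
      ≡⟨ cong₂ (λ T₁ T₂ → + a * T₁ + + b * T₂) (+side 1) (+side 2) ⟩
    + a * (+ 1 + + 2 * + k) + + b * (+ 2 + + 2 * + k)  ≡⟨ ring (+ a) (+ b) (+ k) ⟩
    + 2 * + k * (+ a + + b) + (+ a + + 2 * + b)        ∎
    where
    open ≡-Reasoning
    ring : ∀ A B K → A * (+ 1 + + 2 * K) + B * (+ 2 + + 2 * K) ≡ + 2 * K * (A + B) + (A + + 2 * B)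
    ring = ℤRing.solve-∀

  copies≐Block : 2 ℕ.≤ k → ∀ a → a · B₁ k ≐ Block (+ size a 0)
  copies≐Block _ ℕ.zero = ≐-sym Block-origin
  copies≐Block 2≤k (ℕ.suc a) = begin
    (a · B₁ k) ⊕ B₁ k                     ≈⟨ ⊕-cong (copies≐Block 2≤k a) (≡⇒≐ B₁≡Block) ⟩
    Block (+ size a 0) ⊕ Block (+ side 1)  ≈⟨ Block-⊕ 2≤k (size≡0⊎2k<size a 0) ℕP.≤-refl ⟩
    Block (+ (size a 0 ℕ.+ side 1))
      ≡⟨ cong (λ n → Block (+ n)) (xy∙z≈zx∙y (a ℕ.* side 1) 0 (side 1)) ⟩
    Block (+ size (ℕ.suc a) 0)             ∎
    where open import Relation.Binary.Reasoning.Setoid (≐-setoid Point 0ℓ)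

  sumset≐Block : 2 ℕ.≤ k → ∀ a b → (a · B₁ k) ⊕ (b · B₂ k) ≐ Block (+ size a b)
  sumset≐Block 2≤k a ℕ.zero = ≐-trans ⊕-identityʳ (copies≐Block 2≤k a)
  sumset≐Block 2≤k a (ℕ.suc b) = begin
    (a · B₁ k) ⊕ ((b · B₂ k) ⊕ B₂ k)       ≈⟨ ⊕-assoc ⟩
    ((a · B₁ k) ⊕ (b · B₂ k)) ⊕ B₂ k       ≈⟨ ⊕-cong (sumset≐Block 2≤k a b) (≡⇒≐ B₂≡Block) ⟩
    Block (+ size a b) ⊕ Block (+ side 2)  ≈⟨ Block-⊕ 2≤k (size≡0⊎2k<size a b) (ℕP.n≤1+n _) ⟩
    Block (+ (size a b ℕ.+ side 2))
      ≡⟨ cong (λ n → Block (+ n)) (xy∙z≈x∙zy (a ℕ.* side 1) (b ℕ.* side 2) (side 2)) ⟩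
    Block (+ size a (ℕ.suc b))             ∎
    where open import Relation.Binary.Reasoning.Setoid (≐-setoid Point 0ℓ)

≐⇒⇔ : ∀ {A B : SubsetZ2} → A ≐ B → ∀ z → A z ⇔ B z
≐⇒⇔ (A⊆B , B⊆A) z = mk⇔ A⊆B B⊆A

lemma2p3 : (k : ℕ) → 2 ℕ.≤ k → (a b : ℕ) → (z : Point) →
    ((a · B₁ k) ⊕ (b · B₂ k)) z ⇔
    Shape (+ 2 * + k * (+ a + + b) + (+ a + + 2 * + b))
          (+ 2 * + k * (+ a + + b - + 1) + (+ a + + 2 * + b + + 1))
          (+ k * (+ 2 * + a + + 2 * + b - + 1) + (+ a + + 2 * + b + + 1))
          (+ 2 * + k * (+ a + + b) + (+ a + + 2 * + b - + 1))
          z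
lemma2p3 k 2≤k a b = ≐⇒⇔ (≐-trans (sumset≐Block 2≤k a b) (≡⇒≐ (trans (cong Block (size≡ a b))
  (Block≡Shape (p≡ (+ a) (+ b) (+ k)) (lo≡ (+ a) (+ b) (+ k)) (hi≡ (+ a) (+ b) (+ k))))))
  where
  open Blocks k
  p≡ : ∀ A B K → + 2 * K * (A + B) + (A + + 2 * B) - + 2 * K + + 1
                 ≡ + 2 * K * (A + B - + 1) + (A + + 2 * B + + 1)
  p≡ = ℤRing.solve-∀
  lo≡ : ∀ A B K → + 2 * K * (A + B) + (A + + 2 * B) - K + + 1
                  ≡ K * (+ 2 * A + + 2 * B - + 1) + (A + + 2 * B + + 1)
  lo≡ = ℤRing.solve-∀
  hi≡ : ∀ A B K → + 2 * K * (A + B) + (A + + 2 * B) - + 1 ≡ + 2 * K * (A + B) + (A + + 2 * B - + 1)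
  hi≡ = ℤRing.solve-∀
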